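{- Let $X',X''$ be a partition of an index set $X$, with sets $X_i$ for $i\in X$; let $\Pi := \prod_{i\in X}X_i$, $\Pi' := \prod_{i\in X'}X_i$, $\Pi'' := \prod_{i\in X''}X_i$, so $\Pi = \Pi'\times\Pi''$ up to re-ordering. Let $\mu$ assign to every subset $A$ of $\Pi$, of $\Pi'$ or of $\Pi''$ a subset $\mu(A)\subseteq A$, and define, for $B\subseteq A$: $B\subseteq A$ is big iff $\mu(A)\subseteq B$. Then for each $i\in\{1,2,3\}$, rule $(S*i)$ holds iff rule $(\mu*i)$ holds, where: $(S*1)$: for all $\Sigma'\subseteq\Pi'$, $\Sigma''\subseteq\Pi''$, $\Delta\subseteq\Sigma'\times\Sigma''$: $\Delta\subseteq\Sigma'\times\Sigma''$ is big iff there is $\Gamma'\times\Gamma''\subseteq\Delta$ with $\Gamma'\subseteq\Sigma'$ big and $\Gamma''\subseteq\Sigma''$ big. $(S*2)$: for all $\Gamma\subseteq\Sigma\subseteq\Pi$: if $\Gamma\subseteq\Sigma$ is big then $\Gamma\upharpoonright X'\subseteq\Sigma\upharpoonright X'$ is big. $(S*3)$: for all $A\subseteq\Sigma\subseteq\Pi$: if $A\subseteq\Sigma$ is big then there is a big $B\subseteq\Pi'\times(\Sigma\upharpoonright X'')$ with $B\upharpoonright X''\subseteq A\upharpoonright X''$. $(\mu*1)$: for all $\Sigma'\subseteq\Pi'$, $\Sigma''\subseteq\Pi''$: $\mu(\Sigma'\times\Sigma'') = \mu(\Sigma')\times\mu(\Sigma'')$. $(\mu*2)$: for all $\Sigma,\Gamma\subseteq\Pi$: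 if $\mu(\Sigma)\subseteq\Gamma$ then $\mu(\Sigma\upharpoonright X')\subseteq\Gamma\upharpoonright X'$. $(\mu*3)$: for all $\Sigma\subseteq\Pi$: $\mu(\Pi'\times(\Sigma\upharpoonright X''))\upharpoonright X''\subseteq\mu(\Sigma)\upharpoonright X''$.
   Context: For $\Sigma\subseteq\Pi$, $\Sigma\upharpoonright X' = \{\sigma\upharpoonright X' : \sigma\in\Sigma\}$, where $\sigma\upharpoonright X'$ is the restriction of the sequence $\sigma$ to $X'$; similarly for $X''$. -}

module Defs where

open import Level using (Level)
open import Data.Product using (_×_; _,_; Σ; ∃; ∃-syntax)
open import Data.Unit.Polymorphic using (⊤)
open import Relation.Unary using (Pred; _⊆_; _≐_; _⟨×⟩_)
open import Function.Bundles using (_⇔_)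

-- The product Π = Π' × Π'' (after re-ordering); elements are pairs (σ' , σ'').
-- A "choice" μ on a type assigns to each subset A a subset μ(A) ⊆ A;
-- since subsets are sets, μ must respect extensional equality of subsets.
record Choice {ℓ : Level} (A : Set ℓ) : Set (Level.suc ℓ) where
  field
    μ      : Pred A ℓ → Pred A ℓ
    μ⊆     : ∀ (S : Pred A ℓ) → μ S ⊆ S
    μ-ext  : ∀ (S T : Pred A ℓ) → S ≐ T → μ S ≐ μ T
open Choice public

module _ {ℓ : Level} {P' P'' : Set ℓ} where

  _↾′ : Pred (P' × P'') ℓ → Pred P' ℓ
  (S ↾′) a = ∃[ b ] S (a , b)

  _↾″ : Pred (P' × P'') ℓ → Pred P'' ℓ
  (S ↾″) b = ∃[ a ] S (a , b)

Full : {ℓ : Level} (A : Set ℓ) → Pred A ℓ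
Full A _ = ⊤

Big : {ℓ : Level} {A : Set ℓ} → Choice A → Pred A ℓ → Pred A ℓ → Set ℓ
Big c B A = B ⊆ A × μ c A ⊆ B

module Rules {ℓ : Level} {P' P'' : Set ℓ}
             (m : Choice (P' × P'')) (m' : Choice P') (m'' : Choice P'') where

  S*1 : Set (Level.suc ℓ)
  S*1 = ∀ (Σ' : Pred P' ℓ) (Σ'' : Pred P'' ℓ) (Δ : Pred (P' × P'') ℓ) →
        Δ ⊆ (Σ' ⟨×⟩ Σ'') →
        (Big m Δ (Σ' ⟨×⟩ Σ'') ⇔
          (∃[ Γ' ] ∃[ Γ'' ] ((Γ' ⟨×⟩ Γ'') ⊆ Δ × Big m' Γ' Σ' × Big m'' Γ'' Σ'')))

  S*2 : Set (Level.suc ℓ)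
  S*2 = ∀ (Γ S : Pred (P' × P'') ℓ) → Γ ⊆ S → Big m Γ S → Big m' (Γ ↾′) (S ↾′)

  S*3 : Set (Level.suc ℓ)
  S*3 = ∀ (A S : Pred (P' × P'') ℓ) → A ⊆ S → Big m A S →
        ∃[ B ] (Big m B (Full P' ⟨×⟩ (S ↾″)) × (B ↾″) ⊆ (A ↾″))

  μ*1 : Set (Level.suc ℓ)
  μ*1 = ∀ (Σ' : Pred P' ℓ) (Σ'' : Pred P'' ℓ) →
        μ m (Σ' ⟨×⟩ Σ'') ≐ (μ m' Σ' ⟨×⟩ μ m'' Σ'')

  μ*2 : Set (Level.suc ℓ)
  μ*2 = ∀ (S Γ : Pred (P' × P'') ℓ) → μ m S ⊆ Γ → μ m' (S ↾′) ⊆ (Γ ↾′)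

  μ*3 : Set (Level.suc ℓ)
  μ*3 = ∀ (S : Pred (P' × P'') ℓ) →
        (μ m (Full P' ⟨×⟩ (S ↾″)) ↾″) ⊆ (μ m S ↾″)

module Submission where

-- Everything rests on one observation: for B ⊆ A, "B ⊆ A is big" just says
-- μ(A) ⊆ B, so μ(A) is the least big subset of A (lemma μ-big).  Hence each
-- rule (S*i), instantiated at the big set μ(A), yields (μ*i); conversely
-- (μ*i) gives (S*i) by composing inclusions with μ(A) ⊆ B.  Since products and restrictions are not
-- injective, the middle set of each chain of inclusions (⊆-trans {j = …})
-- and the sets fed to the monotonicity lemmas are written explicitly.

open import Defs
open import Level using (Level) renaming (suc to lsuc)
open import Data.Product using (_×_; _,_; proj₁; proj₂; ∃-syntax)
open import Function.Bundles using (_⇔_; mk⇔; module Equivalence)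
open import Relation.Unary using (Pred; _⊆_; _⟨×⟩_; _∩_)
open import Relation.Unary.Properties using (⊆-trans)

μ-big : {ℓ : Level} {A : Set ℓ} (c : Choice A) (S : Pred A ℓ) → Big c (μ c S) S
μ-big c S = μ⊆ c S , λ p → p

⟨×⟩-mono : {ℓ : Level} {A B : Set ℓ} {P Q : Pred A ℓ} {R T : Pred B ℓ} →
           P ⊆ Q → R ⊆ T → (P ⟨×⟩ R) ⊆ (Q ⟨×⟩ T)
⟨×⟩-mono P⊆Q R⊆T {a , b} (p , r) = P⊆Q {a} p , R⊆T {b} r

↾′-mono : {ℓ : Level} {P' P'' : Set ℓ} {S T : Pred (P' × P'') ℓ} →
          S ⊆ T → (S ↾′) ⊆ (T ↾′)
↾′-mono S⊆T {a} (b , s) = b , S⊆T {a , b} s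

↾″-mono : {ℓ : Level} {P' P'' : Set ℓ} {S T : Pred (P' × P'') ℓ} →
          S ⊆ T → (S ↾″) ⊆ (T ↾″)
↾″-mono S⊆T {b} (a , s) = a , S⊆T {a , b} s

module Equivalences {ℓ : Level} {P' P'' : Set ℓ}
    (m : Choice (P' × P'')) (m' : Choice P') (m'' : Choice P'') where
  open Rules m m' m''

  big×big : {Σ' Γ' : Pred P' ℓ} {Σ'' Γ'' : Pred P'' ℓ} →
            Big m' Γ' Σ' → Big m'' Γ'' Σ'' →
            (μ m' Σ' ⟨×⟩ μ m'' Σ'') ⊆ (Γ' ⟨×⟩ Γ'')
  big×big {Σ'} {Σ'' = Σ''} (_ , μ'⊆Γ') (_ , μ''⊆Γ'') =
    ⟨×⟩-mono {P = μ m' Σ'} {R = μ m'' Σ''} μ'⊆Γ' μ''⊆Γ''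

  μ×μ⊆ : (Σ' : Pred P' ℓ) (Σ'' : Pred P'' ℓ) →
         (μ m' Σ' ⟨×⟩ μ m'' Σ'') ⊆ (Σ' ⟨×⟩ Σ'')
  μ×μ⊆ Σ' Σ'' = big×big ((λ p → p) , μ⊆ m' Σ') ((λ p → p) , μ⊆ m'' Σ'')

  -- (S*1) ⇒ (μ*1): μ'(Σ') × μ''(Σ'') is big since its factors are, giving ⊆;
  -- μ(Σ' × Σ'') is big, so it contains a product of big sets, giving ⊇.
  S*1⇒μ*1 : S*1 → μ*1
  S*1⇒μ*1 s Σ' Σ'' = μ⊆μ×μ , μ×μ⊆μ
    where
    μ⊆μ×μ : μ m (Σ' ⟨×⟩ Σ'') ⊆ (μ m' Σ' ⟨×⟩ μ m'' Σ'')
    μ⊆μ×μ = proj₂ (Equivalence.from (s Σ' Σ'' (μ m' Σ' ⟨×⟩ μ m'' Σ'') (μ×μ⊆ Σ' Σ''))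
              (μ m' Σ' , μ m'' Σ'' , (λ p → p) , μ-big m' Σ' , μ-big m'' Σ''))

    μ×μ⊆μ : (μ m' Σ' ⟨×⟩ μ m'' Σ'') ⊆ μ m (Σ' ⟨×⟩ Σ'')
    μ×μ⊆μ with Equivalence.to (s Σ' Σ'' (μ m (Σ' ⟨×⟩ Σ'')) (μ⊆ m _))
                              (μ-big m _)
    ... | Γ' , Γ'' , Γ×Γ⊆μ , Γ'-big , Γ''-big =
      ⊆-trans {j = Γ' ⟨×⟩ Γ''} (big×big Γ'-big Γ''-big) Γ×Γ⊆μ

  BigProductIn : Pred P' ℓ → Pred P'' ℓ → Pred (P' × P'') ℓ → Set (lsuc ℓ)
  BigProductIn Σ' Σ'' Δ =
    ∃[ Γ' ] ∃[ Γ'' ] ((Γ' ⟨×⟩ Γ'') ⊆ Δ × Big m' Γ' Σ' × Big m'' Γ'' Σ'')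

  -- (μ*1) ⇒ (S*1): with μ(Σ' × Σ'') = μ'(Σ') × μ''(Σ''), bigness of Δ and of
  -- a product Γ' × Γ'' ⊆ Δ both reduce to containing μ'(Σ') × μ''(Σ'').
  μ*1⇒S*1 : μ*1 → S*1
  μ*1⇒S*1 h Σ' Σ'' Δ Δ⊆ = mk⇔ split join
    where
    split : Big m Δ (Σ' ⟨×⟩ Σ'') → BigProductIn Σ' Σ'' Δ
    split (_ , μ⊆Δ) =
      μ m' Σ' , μ m'' Σ'' ,
      ⊆-trans {j = μ m (Σ' ⟨×⟩ Σ'')} (proj₂ (h Σ' Σ'')) μ⊆Δ ,
      μ-big m' Σ' , μ-big m'' Σ''

    join : BigProductIn Σ' Σ'' Δ → Big m Δ (Σ' ⟨×⟩ Σ'')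
    join (Γ' , Γ'' , Γ×Γ⊆Δ , Γ'-big , Γ''-big) =
      Δ⊆ , ⊆-trans {j = μ m' Σ' ⟨×⟩ μ m'' Σ''} (proj₁ (h Σ' Σ''))
             (⊆-trans {j = Γ' ⟨×⟩ Γ''} (big×big Γ'-big Γ''-big) Γ×Γ⊆Δ)

  -- (S*2) ⇒ (μ*2): if μ(Σ) ⊆ Γ then Γ ∩ Σ ⊆ Σ is big, so its restriction is.
  S*2⇒μ*2 : S*2 → μ*2
  S*2⇒μ*2 s S Γ μ⊆Γ =
    ⊆-trans {j = (Γ ∩ S) ↾′} (proj₂ (s (Γ ∩ S) S proj₂ Γ∩S-big))
            (↾′-mono {S = Γ ∩ S} proj₁)
    where
    Γ∩S-big : Big m (Γ ∩ S) S
    Γ∩S-big = proj₂ , λ p → μ⊆Γ p , μ⊆ m S p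

  μ*2⇒S*2 : μ*2 → S*2
  μ*2⇒S*2 h Γ S Γ⊆S (_ , μ⊆Γ) = ↾′-mono {S = Γ} Γ⊆S , h S Γ μ⊆Γ

  -- (S*3) ⇒ (μ*3): apply (S*3) to the big set μ(Σ); the B it produces
  -- contains μ(Π' × (Σ ↾ X'')).
  S*3⇒μ*3 : S*3 → μ*3
  S*3⇒μ*3 s S with s (μ m S) S (μ⊆ m S) (μ-big m S)
  ... | B , (_ , μ⊆B) , B⊆μS =
    ⊆-trans {j = B ↾″} (↾″-mono {S = μ m (Full P' ⟨×⟩ (S ↾″))} μ⊆B) B⊆μS

  -- (μ*3) ⇒ (S*3): take B = μ(Π' × (Σ ↾ X'')), and use μ(Σ) ⊆ A.
  μ*3⇒S*3 : μ*3 → S*3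
  μ*3⇒S*3 h A S _ (_ , μ⊆A) =
    μ m (Full P' ⟨×⟩ (S ↾″)) , μ-big m _ ,
    ⊆-trans {j = μ m S ↾″} (h S) (↾″-mono {S = μ m S} μ⊆A)

fact4p4 : {ℓ : Level} {P' P'' : Set ℓ}
          (m : Choice (P' × P'')) (m' : Choice P') (m'' : Choice P'') →
          let open Rules m m' m'' in
          (S*1 ⇔ μ*1) × (S*2 ⇔ μ*2) × (S*3 ⇔ μ*3)
fact4p4 m m' m'' =
  mk⇔ S*1⇒μ*1 μ*1⇒S*1 , mk⇔ S*2⇒μ*2 μ*2⇒S*2 , mk⇔ S*3⇒μ*3 μ*3⇒S*3
  where open Equivalences m m' m''
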